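{- There is a constant $c$ such that for all positive integers $k,v$ there is a first-order formula $\alpha_k(g;x_1,\dots,x_k)$ in the language of monoids $L(e,\circ)$ with $|\alpha_k|\le c(k+\log v)$ such that for every group $G$ with $|G|\le v$ and all $g,x_1,\dots,x_k\in G$: $G\models\alpha_k(g;x_1,\dots,x_k)$ if and only if $g\in\langle x_1,\dots,x_k\rangle$.
   Context: $\langle x_1,\dots,x_k\rangle$ is the subgroup generated by $x_1,\dots,x_k$. $|\alpha|$ is the number of symbols of the formula, each variable counting as one symbol. Here $\log m=\min\{r\in\mathbb N:2^r\ge m\}$. -}

module Defs where

open import Level using (0ℓ)
open import Data.Nat using (ℕ; zero; suc; _+_)
open import Data.Fin using (Fin; toℕ)
open import Data.Product using (Σ; _×_; _,_)
open import Data.Sum using (_⊎_)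
open import Data.Empty using (⊥)
open import Relation.Binary.PropositionalEquality using (_≡_)
import Data.Nat
import Relation.Nullary
open import Algebra.Bundles using (Group)

data Term : Set where
  var : ℕ → Term
  e   : Term
  _∘_ : Term → Term → Term

data Formula : Set where
  _≐_  : Term → Term → Formula
  ¬'_  : Formula → Formula
  _∧'_ : Formula → Formula → Formula
  _∨'_ : Formula → Formula → Formula
  _⇒'_ : Formula → Formula → Formula
  ∃'   : ℕ → Formula → Formula
  ∀'   : ℕ → Formula → Formula

termSize : Term → ℕ
termSize (var _) = 1
termSize e       = 1
termSize (s ∘ t) = suc (termSize s + termSize t)

size : Formula → ℕ
size (s ≐ t)  = suc (termSize s + termSize t)
size (¬' φ)   = suc (size φ)
size (φ ∧' ψ) = suc (size φ + size ψ)
size (φ ∨' ψ) = suc (size φ + size ψ)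
size (φ ⇒' ψ) = suc (size φ + size ψ)
size (∃' _ φ) = suc (suc (size φ))
size (∀' _ φ) = suc (suc (size φ))

module _ (G : Group 0ℓ 0ℓ) where
  open Group G renaming (Carrier to A)

  _[_↦_] : (ℕ → A) → ℕ → A → (ℕ → A)
  (ρ [ x ↦ a ]) y with Data.Nat._≟_ x y
  ... | Relation.Nullary.yes _ = a
  ... | Relation.Nullary.no _  = ρ y

  ⟦_⟧ₜ : Term → (ℕ → A) → A
  ⟦ var x ⟧ₜ ρ = ρ x
  ⟦ e ⟧ₜ     ρ = ε
  ⟦ s ∘ t ⟧ₜ ρ = ⟦ s ⟧ₜ ρ ∙ ⟦ t ⟧ₜ ρ

  Sat : (ℕ → A) → Formula → Set
  Sat ρ (s ≐ t)  = ⟦ s ⟧ₜ ρ ≈ ⟦ t ⟧ₜ ρ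
  Sat ρ (¬' φ)   = Sat ρ φ → ⊥
  Sat ρ (φ ∧' ψ) = Sat ρ φ × Sat ρ ψ
  Sat ρ (φ ∨' ψ) = Sat ρ φ ⊎ Sat ρ ψ
  Sat ρ (φ ⇒' ψ) = Sat ρ φ → Sat ρ ψ
  Sat ρ (∃' x φ) = Σ A λ a → Sat (ρ [ x ↦ a ]) φ
  Sat ρ (∀' x φ) = (a : A) → Sat (ρ [ x ↦ a ]) φ

  data ⟨_⟩∋_ {k : ℕ} (xs : Fin k → A) : A → Set where
    gen  : ∀ i → ⟨ xs ⟩∋ xs i
    unit : ⟨ xs ⟩∋ ε
    mul  : ∀ {a b} → ⟨ xs ⟩∋ a → ⟨ xs ⟩∋ b → ⟨ xs ⟩∋ (a ∙ b)
    inv  : ∀ {a} → ⟨ xs ⟩∋ a → ⟨ xs ⟩∋ (a ⁻¹)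
    resp : ∀ {a b} → a ≈ b → ⟨ xs ⟩∋ a → ⟨ xs ⟩∋ b

  CardLe : ℕ → Set
  CardLe v = Σ (A → Fin v) λ f →
               ((∀ {a b} → a ≈ b → f a ≡ f b) × (∀ {a b} → f a ≡ f b → a ≈ b))

-- α_k(g; x₁,…,x_k) says that g is a product of 2^⌈log₂ v⌉ factors, each equal to e or to
-- some x_i^{±1}.  "g is a product of 2^(r+1) such factors" is expressed by splitting g into
-- two halves and quantifying universally over a variable z that must be one of them, so that
-- the formula for radius 2^r occurs only once and the size grows linearly in r.  Every element
-- of ⟨x₁,…,x_k⟩ is a word in the x_i^{±1}, and a shortest such word has pairwise distinct
-- prefix values, hence length below |G| ≤ v ≤ 2^⌈log₂ v⌉.
module Submission where

open import Defs
open import Level using (0ℓ)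
open import Data.Nat using (ℕ; zero; suc; _+_; _*_; _∸_; _⊓_; _^_; _≤_; _<_; z≤n; s≤s; ⌈_/2⌉)
open import Data.Nat.Properties
open import Data.Nat.Logarithm using (⌈log₂_⌉)
open import Data.Nat.Logarithm.Core using (⌈log2⌉)
open import Data.Nat.Induction using (<-wellFounded)
open import Data.Nat.Tactic.RingSolver using (solve-∀)
open import Data.Fin as Fin using (Fin; toℕ)
open import Data.Fin.Properties using (toℕ<n; toℕ≤pred[n]; pigeonhole)
open import Data.List using (List; []; _∷_; [_]; _++_; length; take; drop)
open import Data.List.Properties using (length-++; length-take; length-drop; take++drop≡id)
open import Data.Sign using (Sign; opposite) renaming (+ to plus; - to minus)
open import Data.Product using (Σ; _×_; _,_)
open import Data.Sum using (_⊎_; inj₁; inj₂)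
open import Data.Sum.Function.Propositional using (_⊎-⇔_)
open import Data.Empty using (⊥-elim)
open import Function using (_on_)
open import Function.Bundles using (_⇔_; mk⇔; Equivalence)
open import Function.Construct.Composition using (_⇔-∘_)
open import Function.Construct.Symmetry using (⇔-sym)
open import Function.Construct.Identity using (⇔-id)
open import Induction.WellFounded using (Acc; acc)
open import Relation.Binary.Construct.On as On using ()
open import Relation.Binary.PropositionalEquality as ≡ using (_≡_; _≢_; cong; cong₂; ≢-sym)
open import Relation.Nullary using (yes; no)
open import Algebra.Bundles using (Group)

n≤2^⌈log2⌉n : ∀ n (acc-n : Acc _<_ n) → n ≤ 2 ^ ⌈log2⌉ n acc-n
n≤2^⌈log2⌉n zero          _        = z≤n
n≤2^⌈log2⌉n (suc zero)    _        = s≤s z≤n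
n≤2^⌈log2⌉n (suc (suc n)) (acc rs) = begin
    2 + n          ≤⟨ +-monoʳ-≤ 2 n≤c+c ⟩
    2 + (c + c)    ≡⟨ double-suc c ⟩
    2 * suc c      ≤⟨ *-monoʳ-≤ 2 (n≤2^⌈log2⌉n (suc c) _) ⟩
    2 * 2 ^ ⌈log2⌉ (suc c) (rs (⌈n/2⌉<n n)) ∎
  where
  open ≤-Reasoning
  c = ⌈ n /2⌉
  double-suc : ∀ m → 2 + (m + m) ≡ 2 * suc m
  double-suc = solve-∀
  n≤c+c : n ≤ c + c
  n≤c+c = ≡.subst (_≤ c + c) (⌊n/2⌋+⌈n/2⌉≡n n) (+-monoˡ-≤ c (⌊n/2⌋≤⌈n/2⌉ n))

n≤2^⌈log₂n⌉ : ∀ n → n ≤ 2 ^ ⌈log₂ n ⌉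
n≤2^⌈log₂n⌉ n = n≤2^⌈log2⌉n n _

length-take++drop< : ∀ {a} {X : Set a} {i j} (xs : List X) →
                     i < j → j ≤ length xs → length (take i xs ++ drop j xs) < length xs
length-take++drop< {i = i} {j} xs i<j j≤n = begin-strict
    length (take i xs ++ drop j xs)      ≡⟨ length-++ (take i xs) ⟩
    length (take i xs) + length (drop j xs)
      ≡⟨ cong₂ _+_ (length-take i xs) (length-drop j xs) ⟩
    i ⊓ length xs + (length xs ∸ j)      ≤⟨ +-monoˡ-≤ _ (m⊓n≤m i _) ⟩
    i + (length xs ∸ j)                  <⟨ +-monoˡ-< _ i<j ⟩
    j + (length xs ∸ j)                  ≡⟨ m+[n∸m]≡n j≤n ⟩
    length xs                            ∎
  where open ≤-Reasoning

⊥′ : Formula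
⊥′ = ¬' (e ≐ e)

⋁ : ∀ {n} → (Fin n → Formula) → Formula
⋁ {zero}  φs = ⊥′
⋁ {suc n} φs = φs Fin.zero ∨' ⋁ (λ i → φs (Fin.suc i))

size-⋁ : ∀ {n} c (φs : Fin n → Formula) → (∀ i → size (φs i) ≡ c) → size (⋁ φs) ≡ 4 + n * suc c
size-⋁ {zero}  c φs sizes = ≡.refl
size-⋁ {suc n} c φs sizes = begin
    suc (size (φs _) + size (⋁ _))
      ≡⟨ cong₂ (λ s t → suc (s + t)) (sizes _) (size-⋁ c _ (λ _ → sizes _)) ⟩
    suc (c + (4 + n * suc c))         ≡⟨ shuffle c (n * suc c) ⟩
    4 + suc n * suc c                 ∎
  where
  open ≡.≡-Reasoning
  shuffle : ∀ c m → suc (c + (4 + m)) ≡ 4 + (suc c + m)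
  shuffle = solve-∀

module ProductFormula (k : ℕ) where

  genVar : Fin k → ℕ
  genVar i = suc (toℕ i)

  va vb vz : ℕ
  va = suc k
  vb = suc va
  vz = suc vb

  k<va : k < va
  k<va = n<1+n k

  k<vb : k < vb
  k<vb = m<n⇒m<1+n k<va

  k<vz : k < vz
  k<vz = m<n⇒m<1+n k<vb

  a≢b : va ≢ vb
  a≢b = <⇒≢ (n<1+n va)

  a≢z : va ≢ vz
  a≢z = <⇒≢ (m<n⇒m<1+n (n<1+n va))

  b≢z : vb ≢ vz
  b≢z = <⇒≢ (n<1+n vb)

  isLetter : ℕ → Fin k → Formula
  isLetter y i = (var y ≐ var (genVar i)) ∨' ((var y ∘ var (genVar i)) ≐ e)

  isProduct : ℕ → ℕ → Formula
  isProduct zero    y = (var y ≐ e) ∨' ⋁ (isLetter y)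
  isProduct (suc r) y =
    ∃' va (∃' vb ((var y ≐ (var va ∘ var vb)) ∧'
      ∀' vz (((var vz ≐ var va) ∨' (var vz ≐ var vb)) ⇒' isProduct r vz)))

  size-isProduct : ∀ r y → size (isProduct r y) ≡ 20 * r + (8 + k * 10)
  size-isProduct zero    y = cong (4 +_) (size-⋁ 9 (isLetter y) (λ _ → ≡.refl))
  size-isProduct (suc r) y = begin
    20 + size (isProduct r vz)         ≡⟨ cong (20 +_) (size-isProduct r vz) ⟩
    20 + (20 * r + (8 + k * 10))       ≡⟨ +-assoc 20 (20 * r) _ ⟨
    20 + 20 * r + (8 + k * 10)         ≡⟨ cong (_+ (8 + k * 10)) (*-suc 20 r) ⟨
    20 * suc r + (8 + k * 10)          ∎
    where open ≡.≡-Reasoning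

  size-isProduct≤ : ∀ r → 1 ≤ k → size (isProduct r 0) ≤ 20 * (k + r)
  size-isProduct≤ r (s≤s {n = k′} _) = begin
    size (isProduct r 0)                                   ≡⟨ size-isProduct r 0 ⟩
    20 * r + (8 + suc k′ * 10)                             ≤⟨ m≤m+n _ (2 + 10 * k′) ⟩
    20 * r + (8 + suc k′ * 10) + (2 + 10 * k′)             ≡⟨ regroup k′ r ⟩
    20 * (suc k′ + r)                                      ∎
    where
    open ≤-Reasoning
    regroup : ∀ k r → 20 * r + (8 + suc k * 10) + (2 + 10 * k) ≡ 20 * (suc k + r)
    regroup = solve-∀

module _ (G : Group 0ℓ 0ℓ) where
  open Group G renaming (Carrier to A)
  open import Algebra.Properties.Group G using (inverseˡ-unique; ε⁻¹≈ε; ⁻¹-involutive; ⁻¹-anti-homo-∙)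
  open import Relation.Binary.Reasoning.Setoid setoid

  _[_≔_] : (ℕ → A) → ℕ → A → ℕ → A
  _[_≔_] = _[_↦_] G

  ≔-same : ∀ ρ x a → (ρ [ x ≔ a ]) x ≈ a
  ≔-same ρ x a with x ≟ x
  ... | yes _ = refl
  ... | no x≢x = ⊥-elim (x≢x ≡.refl)

  ≔-other : ∀ ρ {x y} a → x ≢ y → (ρ [ x ≔ a ]) y ≈ ρ y
  ≔-other ρ {x} {y} a x≢y with x ≟ y
  ... | yes x≡y = ⊥-elim (x≢y x≡y)
  ... | no _ = refl

  ≈-⇔ : ∀ {a a′ b b′} → a ≈ a′ → b ≈ b′ → (a ≈ b) ⇔ (a′ ≈ b′)
  ≈-⇔ a≈a′ b≈b′ = mk⇔ (λ a≈b → trans (sym a≈a′) (trans a≈b b≈b′))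
                       (λ a′≈b′ → trans a≈a′ (trans a′≈b′ (sym b≈b′)))

  Sat-⋁ : ∀ {n} ρ (φs : Fin n → Formula) → Sat G ρ (⋁ φs) ⇔ Σ (Fin n) λ i → Sat G ρ (φs i)
  Sat-⋁ {zero}  ρ φs = mk⇔ (λ ¬e≈e → ⊥-elim (¬e≈e refl)) λ ()
  Sat-⋁ {suc n} ρ φs = mk⇔ to from
    where
    rest = Sat-⋁ ρ (λ i → φs (Fin.suc i))
    to : Sat G ρ (⋁ φs) → Σ (Fin (suc n)) λ i → Sat G ρ (φs i)
    to (inj₁ s) = _ , s
    to (inj₂ s) with Equivalence.to rest s
    ... | i , t = Fin.suc i , t
    from : (Σ (Fin (suc n)) λ i → Sat G ρ (φs i)) → Sat G ρ (⋁ φs)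
    from (Fin.zero , s)  = inj₁ s
    from (Fin.suc i , s) = inj₂ (Equivalence.from rest (i , s))

  module Words {k : ℕ} (xs : Fin k → A) where

    Letter : Set
    Letter = Fin k × Sign

    ⟦_⟧ˡ : Letter → A
    ⟦ i , plus ⟧ˡ  = xs i
    ⟦ i , minus ⟧ˡ = xs i ⁻¹

    Word : Set
    Word = List Letter

    eval : Word → A
    eval []      = ε
    eval (l ∷ w) = ⟦ l ⟧ˡ ∙ eval w

    eval-++ : ∀ u w → eval (u ++ w) ≈ eval u ∙ eval w
    eval-++ []      w = sym (identityˡ _)
    eval-++ (l ∷ u) w = trans (∙-congˡ (eval-++ u w)) (sym (assoc _ _ _))

    invertˡ : Letter → Letter
    invertˡ (i , s) = i , opposite s

    ⟦invertˡ⟧ : ∀ l → ⟦ invertˡ l ⟧ˡ ≈ ⟦ l ⟧ˡ ⁻¹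
    ⟦invertˡ⟧ (i , plus)  = refl
    ⟦invertˡ⟧ (i , minus) = sym (⁻¹-involutive _)

    invert : Word → Word
    invert []      = []
    invert (l ∷ w) = invert w ++ [ invertˡ l ]

    eval-invert : ∀ w → eval (invert w) ≈ eval w ⁻¹
    eval-invert []      = sym ε⁻¹≈ε
    eval-invert (l ∷ w) = begin
      eval (invert w ++ [ invertˡ l ])       ≈⟨ eval-++ (invert w) _ ⟩
      eval (invert w) ∙ (⟦ invertˡ l ⟧ˡ ∙ ε) ≈⟨ ∙-cong (eval-invert w) (trans (identityʳ _) (⟦invertˡ⟧ l)) ⟩
      eval w ⁻¹ ∙ ⟦ l ⟧ˡ ⁻¹                  ≈⟨ ⁻¹-anti-homo-∙ ⟦ l ⟧ˡ (eval w) ⟨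
      (⟦ l ⟧ˡ ∙ eval w) ⁻¹                   ∎

    ⟨xs⟩∋eval : ∀ w → ⟨_⟩∋_ G xs (eval w)
    ⟨xs⟩∋eval []               = unit
    ⟨xs⟩∋eval ((i , plus) ∷ w)  = mul (gen i) (⟨xs⟩∋eval w)
    ⟨xs⟩∋eval ((i , minus) ∷ w) = mul (inv (gen i)) (⟨xs⟩∋eval w)

    ⟨xs⟩∋⇒word : ∀ {a} → ⟨_⟩∋_ G xs a → Σ Word λ w → eval w ≈ a
    ⟨xs⟩∋⇒word (gen i) = [ i , plus ] , identityʳ _
    ⟨xs⟩∋⇒word unit    = [] , refl
    ⟨xs⟩∋⇒word (mul p q) with ⟨xs⟩∋⇒word p | ⟨xs⟩∋⇒word q
    ... | u , u≈a | w , w≈b = u ++ w , trans (eval-++ u w) (∙-cong u≈a w≈b)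
    ⟨xs⟩∋⇒word (inv p) with ⟨xs⟩∋⇒word p
    ... | w , w≈a = invert w , trans (eval-invert w) (⁻¹-cong w≈a)
    ⟨xs⟩∋⇒word (resp a≈b p) with ⟨xs⟩∋⇒word p
    ... | w , w≈a = w , trans w≈a a≈b

    InBall : ℕ → A → Set
    InBall n a = Σ Word λ w → length w ≤ n × eval w ≈ a

    InBall-resp : ∀ {n a b} → a ≈ b → InBall n a → InBall n b
    InBall-resp a≈b (w , |w|≤n , w≈a) = w , |w|≤n , trans w≈a a≈b

    InBall-mono : ∀ {m n a} → m ≤ n → InBall m a → InBall n a
    InBall-mono m≤n (w , |w|≤m , w≈a) = w , ≤-trans |w|≤m m≤n , w≈a

    InBall-one : ∀ {a} → InBall 1 a ⇔ (a ≈ ε ⊎ Σ Letter λ l → a ≈ ⟦ l ⟧ˡ)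
    InBall-one = mk⇔ to from
      where
      to : ∀ {a} → InBall 1 a → a ≈ ε ⊎ Σ Letter λ l → a ≈ ⟦ l ⟧ˡ
      to ([]    , _ , ε≈a)   = inj₁ (sym ε≈a)
      to (l ∷ [] , _ , l∙ε≈a) = inj₂ (l , trans (sym l∙ε≈a) (identityʳ _))
      to (_ ∷ _ ∷ _ , s≤s () , _)
      from : ∀ {a} → a ≈ ε ⊎ (Σ Letter λ l → a ≈ ⟦ l ⟧ˡ) → InBall 1 a
      from (inj₁ a≈ε)       = [] , z≤n , sym a≈ε
      from (inj₂ (l , a≈l)) = [ l ] , ≤-refl , trans (identityʳ _) (sym a≈l)

    InBall-+ : ∀ {m n a} → InBall (m + n) a ⇔ Σ A λ p → Σ A λ q → a ≈ p ∙ q × InBall m p × InBall n q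
    InBall-+ {m} {n} = mk⇔ to from
      where
      to : ∀ {a} → InBall (m + n) a → Σ A λ p → Σ A λ q → a ≈ p ∙ q × InBall m p × InBall n q
      to (w , |w|≤m+n , w≈a) =
        _ , _ ,
        trans (sym w≈a) (trans (reflexive (cong eval (≡.sym (take++drop≡id m w)))) (eval-++ (take m w) _)) ,
        (take m w , ≤-trans (≤-reflexive (length-take m w)) (m⊓n≤m m _) , refl) ,
        (drop m w , ≤-trans (≤-reflexive (length-drop m w)) (m≤n+o⇒m∸n≤o _ m |w|≤m+n) , refl)
      from : ∀ {a} → (Σ A λ p → Σ A λ q → a ≈ p ∙ q × InBall m p × InBall n q) → InBall (m + n) a
      from (p , q , a≈pq , (u , |u|≤m , u≈p) , (w , |w|≤n , w≈q)) =
        u ++ w ,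
        ≤-trans (≤-reflexive (length-++ u)) (+-mono-≤ |u|≤m |w|≤n) ,
        trans (eval-++ u w) (trans (∙-cong u≈p w≈q) (sym a≈pq))

    InBall-2* : ∀ {n a} → InBall (2 * n) a ⇔ Σ A λ p → Σ A λ q → a ≈ p ∙ q × InBall n p × InBall n q
    InBall-2* {n} {a} =
      ≡.subst (λ m → InBall (2 * n) a ⇔ Σ A λ p → Σ A λ q → a ≈ p ∙ q × InBall n p × InBall m q)
              (+-identityʳ n) InBall-+

    module Shortening {v} (code : A → Fin v) (code-injective : ∀ {a b} → code a ≡ code b → a ≈ b) where

      -- Among the length w + 1 > v prefixes of w two share their value, and the letters
      -- between them can be cut out.
      shorten : ∀ w → v ≤ length w → Σ Word λ w′ → length w′ < length w × eval w′ ≈ eval w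
      shorten w v≤|w| with pigeonhole (s≤s v≤|w|) (λ i → code (eval (take (toℕ i) w)))
      ... | i , j , i<j , same-code =
        take (toℕ i) w ++ drop (toℕ j) w ,
        length-take++drop< w i<j (toℕ≤pred[n] j) ,
        excise (code-injective same-code)
        where
        excise : eval (take (toℕ i) w) ≈ eval (take (toℕ j) w) →
                 eval (take (toℕ i) w ++ drop (toℕ j) w) ≈ eval w
        excise i≈j = begin
          eval (take (toℕ i) w ++ drop (toℕ j) w)        ≈⟨ eval-++ (take (toℕ i) w) _ ⟩
          eval (take (toℕ i) w) ∙ eval (drop (toℕ j) w)  ≈⟨ ∙-congʳ i≈j ⟩
          eval (take (toℕ j) w) ∙ eval (drop (toℕ j) w)  ≈⟨ eval-++ (take (toℕ j) w) _ ⟨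
          eval (take (toℕ j) w ++ drop (toℕ j) w)        ≡⟨ cong eval (take++drop≡id (toℕ j) w) ⟩
          eval w                                         ∎

      short-word : ∀ w → Acc (_<_ on length) w → Σ Word λ w′ → length w′ < v × eval w′ ≈ eval w
      short-word w (acc rs) with length w <? v
      ... | yes |w|<v = w , |w|<v , refl
      ... | no |w|≮v with shorten w (≮⇒≥ |w|≮v)
      ...   | w′ , |w′|<|w| , w′≈w with short-word w′ (rs |w′|<|w|)
      ...     | w″ , |w″|<v , w″≈w′ = w″ , |w″|<v , trans w″≈w′ w′≈w

      ⟨xs⟩∋⇒InBall : ∀ {a} → ⟨_⟩∋_ G xs a → InBall v a
      ⟨xs⟩∋⇒InBall a∈ with ⟨xs⟩∋⇒word a∈
      ... | w , w≈a with short-word w (On.wellFounded length <-wellFounded w)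
      ...   | w′ , |w′|<v , w′≈w = w′ , <⇒≤ |w′|<v , trans w′≈w w≈a

    InBall⇒⟨xs⟩∋ : ∀ {n a} → InBall n a → ⟨_⟩∋_ G xs a
    InBall⇒⟨xs⟩∋ (w , _ , w≈a) = resp w≈a (⟨xs⟩∋eval w)

  module Semantics {k : ℕ} (xs : Fin k → A) where
    open ProductFormula k
    open Words xs

    Interprets : (ℕ → A) → Set
    Interprets ρ = ∀ i → ρ (genVar i) ≈ xs i

    Interprets-≔ : ∀ {ρ x} a → k < x → Interprets ρ → Interprets (ρ [ x ≔ a ])
    Interprets-≔ {ρ} a k<x ρ⊨xs i =
      trans (≔-other ρ a (≢-sym (<⇒≢ (≤-<-trans (toℕ<n i) k<x)))) (ρ⊨xs i)

    withHalves : (ℕ → A) → A → A → ℕ → A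
    withHalves ρ p q = ρ [ va ≔ p ] [ vb ≔ q ]

    withHalves-y : ∀ ρ {p q y} → y ≢ va → y ≢ vb → withHalves ρ p q y ≈ ρ y
    withHalves-y ρ {p} {q} y≢a y≢b = trans (≔-other _ q (≢-sym y≢b)) (≔-other ρ p (≢-sym y≢a))

    withHalves-a : ∀ ρ {p q} → withHalves ρ p q va ≈ p
    withHalves-a ρ {p} {q} = trans (≔-other _ q (≢-sym a≢b)) (≔-same ρ va p)

    withHalves-b : ∀ ρ {p q} → withHalves ρ p q vb ≈ q
    withHalves-b ρ {p} {q} = ≔-same (ρ [ va ≔ p ]) vb q

    Interprets-withHalves : ∀ {ρ p q} → Interprets ρ → Interprets (withHalves ρ p q)
    Interprets-withHalves {p = p} {q} ρ⊨xs = Interprets-≔ q k<vb (Interprets-≔ p k<va ρ⊨xs)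

    Sat-isLetter : ∀ {ρ} y i → Interprets ρ → Sat G ρ (isLetter y i) ⇔ Σ Sign λ s → ρ y ≈ ⟦ i , s ⟧ˡ
    Sat-isLetter {ρ} y i ρ⊨xs = mk⇔ to from
      where
      to : Sat G ρ (isLetter y i) → Σ Sign λ s → ρ y ≈ ⟦ i , s ⟧ˡ
      to (inj₁ y≈x)   = plus , trans y≈x (ρ⊨xs i)
      to (inj₂ y∙x≈ε) = minus , inverseˡ-unique _ _ (trans (∙-congˡ (sym (ρ⊨xs i))) y∙x≈ε)
      from : (Σ Sign λ s → ρ y ≈ ⟦ i , s ⟧ˡ) → Sat G ρ (isLetter y i)
      from (plus , y≈x)  = inj₁ (trans y≈x (sym (ρ⊨xs i)))
      from (minus , y≈x⁻¹) = inj₂ (trans (∙-cong y≈x⁻¹ (ρ⊨xs i)) (inverseˡ (xs i)))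

    Sat-isProduct : ∀ r {ρ} y → Interprets ρ → y ≢ va → y ≢ vb →
                    Sat G ρ (isProduct r y) ⇔ InBall (2 ^ r) (ρ y)
    Sat-isProduct zero {ρ} y ρ⊨xs _ _ =
      ⇔-sym InBall-one ⇔-∘ (⇔-id _ ⊎-⇔ letters)
      where
      letters : Sat G ρ (⋁ (isLetter y)) ⇔ Σ Letter λ l → ρ y ≈ ⟦ l ⟧ˡ
      letters = mk⇔
        (λ sat → let i , t   = Equivalence.to (Sat-⋁ ρ (isLetter y)) sat
                     s , y≈l = Equivalence.to (Sat-isLetter {ρ} y i ρ⊨xs) t
                 in (i , s) , y≈l)
        (λ { ((i , s) , y≈l) → Equivalence.from (Sat-⋁ ρ (isLetter y))
                                 (i , Equivalence.from (Sat-isLetter {ρ} y i ρ⊨xs) (s , y≈l)) })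
    Sat-isProduct (suc r) {ρ} y ρ⊨xs y≢a y≢b = ⇔-sym InBall-2* ⇔-∘ mk⇔ to from
      where
      ρ₃ : A → A → A → ℕ → A
      ρ₃ p q w = withHalves ρ p q [ vz ≔ w ]
      half : ∀ p q w → Sat G (ρ₃ p q w) (isProduct r vz) ⇔ InBall (2 ^ r) w
      half p q w = mk⇔ (λ sat → InBall-resp z≈w (Equivalence.to IH sat))
                       (λ w∈ → Equivalence.from IH (InBall-resp (sym z≈w) w∈))
        where
        z≈w = ≔-same (withHalves ρ p q) vz w
        IH = Sat-isProduct r vz (Interprets-≔ w k<vz (Interprets-withHalves ρ⊨xs)) (≢-sym a≢z) (≢-sym b≢z)
      isHalf : ∀ p q w → Sat G (ρ₃ p q w) ((var vz ≐ var va) ∨' (var vz ≐ var vb)) ⇔ (w ≈ p ⊎ w ≈ q)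
      isHalf p q w = ≈-⇔ z≈w (trans (≔-other _ w (≢-sym a≢z)) (withHalves-a ρ))
                 ⊎-⇔ ≈-⇔ z≈w (trans (≔-other _ w (≢-sym b≢z)) (withHalves-b ρ))
        where z≈w = ≔-same (withHalves ρ p q) vz w
      product : ∀ p q → Sat G (withHalves ρ p q) (var y ≐ (var va ∘ var vb)) ⇔ (ρ y ≈ p ∙ q)
      product p q = ≈-⇔ (withHalves-y ρ y≢a y≢b) (∙-cong (withHalves-a ρ) (withHalves-b ρ))
      to : Sat G ρ (isProduct (suc r) y) →
           Σ A λ p → Σ A λ q → ρ y ≈ p ∙ q × InBall (2 ^ r) p × InBall (2 ^ r) q
      to (p , q , y≈ab , halves) =
        p , q , Equivalence.to (product p q) y≈ab ,
        Equivalence.to (half p q p) (halves p (Equivalence.from (isHalf p q p) (inj₁ refl))) ,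
        Equivalence.to (half p q q) (halves q (Equivalence.from (isHalf p q q) (inj₂ refl)))
      from : (Σ A λ p → Σ A λ q → ρ y ≈ p ∙ q × InBall (2 ^ r) p × InBall (2 ^ r) q) →
             Sat G ρ (isProduct (suc r) y)
      from (p , q , y≈pq , p∈ , q∈) =
        p , q , Equivalence.from (product p q) y≈pq ,
        λ w w-half → Equivalence.from (half p q w) (in-ball w (Equivalence.to (isHalf p q w) w-half))
        where
        in-ball : ∀ w → w ≈ p ⊎ w ≈ q → InBall (2 ^ r) w
        in-ball w (inj₁ w≈p) = InBall-resp (sym w≈p) p∈
        in-ball w (inj₂ w≈q) = InBall-resp (sym w≈q) q∈

lemma2p4 : Σ ℕ λ c → (k v : ℕ) → 1 ≤ k → 1 ≤ v →
  Σ Formula λ α → size α ≤ c * (k + ⌈log₂ v ⌉) ×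
    ((G : Group 0ℓ 0ℓ) → CardLe G v → (ρ : ℕ → Group.Carrier G) →
      (Sat G ρ α ⇔ ⟨_⟩∋_ G {k} (λ i → ρ (suc (toℕ i))) (ρ 0)))
lemma2p4 = 20 , λ k v 1≤k _ →
  isProduct k ⌈log₂ v ⌉ 0 , size-isProduct≤ k ⌈log₂ v ⌉ 1≤k ,
  λ { G (code , _ , code-injective) ρ →
    let xs = λ i → ρ (suc (toℕ i))
        open Words G xs
        open Shortening code code-injective
        open Semantics G xs
        sat⇔ball = Sat-isProduct ⌈log₂ v ⌉ 0 (λ _ → Group.refl G) (λ ()) (λ ())
    in mk⇔ (λ sat → InBall⇒⟨xs⟩∋ (Equivalence.to sat⇔ball sat))
           (λ g∈ → Equivalence.from sat⇔ball (InBall-mono (n≤2^⌈log₂n⌉ v) (⟨xs⟩∋⇒InBall g∈))) }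
  where open ProductFormula using (isProduct; size-isProduct≤)
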